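{- Let $q=q(n)$ and $\rho=\rho(n)$ be positive integer functions with $q=\omega(\sqrt{\log n})$, $q=o(\sqrt{n\log n})$ and $\rho=O(q^2/\log n)$. Let $a_1,a_2,\dots$ be agents drawn independently and uniformly at random from a population of $n$ agents, call draw $a_j$ a collision if $a_j\in\{a_1,\dots,a_{j-1}\}$, and let $L_\rho$ be the index of the $\rho$-th collision (equivalently, $L_\rho=\sum_{i=1}^{\rho}\ell_i$ where $\ell_i$ is the number of draws after the $(i-1)$-th collision up to and including the $i$-th collision). Then $\mathbb{E}[L_\rho]=\Theta(\sqrt{\rho n})$ as $n\to\infty$.
   Context: $L_\rho$ is the total number of agents drawn in an epoch consisting of $\rho$ collision-free runs, each ended by a collision (an agent already drawn in the epoch). -}

module Defs where

open import Data.Nat using (ℕ; zero; suc; _+_; _*_; _^_; _≤_; _≥_; NonZero)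
open import Data.Nat.Properties using (m^n≢0)
open import Data.Nat.Logarithm using (⌊log₂_⌋)
open import Data.Fin using (Fin) renaming (_≟_ to _≟ᶠ_)
open import Data.List using (List; []; _∷_; [_]; map; concatMap)
open import Data.Nat.ListAction using (sum)
import Data.List.Membership.DecPropositional as DecMem
open import Relation.Nullary using (yes; no)
open import Data.Product using (Σ; _×_; ∃)
open import Data.Integer using (+_)
open import Data.Rational using (ℚ; 0ℚ; _/_)
import Data.List as L

-- All draw sequences of length m (each of the n ^ m sequences exactly once;
-- under the uniform i.i.d. model each has probability 1 / n ^ m).
allSeqs : (n m : ℕ) → List (List (Fin n))
allSeqs n zero    = [ [] ]
allSeqs n (suc m) = concatMap (λ a → map (a ∷_) (allSeqs n m)) (L.allFin n)

-- collIdx seen k j ds : scan draws ds, where 'seen' are the agents drawn so far,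
-- k collisions are still to be found, and j draws have been made so far.
collIdx : {n : ℕ} → List (Fin n) → ℕ → ℕ → List (Fin n) → ℕ
collIdx seen zero    j ds       = j
collIdx seen (suc k) j []       = j   -- never reached for sequences of length n + ρ
collIdx {n} seen (suc k) j (a ∷ ds) with DecMem._∈?_ (_≟ᶠ_ {n}) a seen
... | yes _ = collIdx seen k (suc j) ds
... | no  _ = collIdx (a ∷ seen) (suc k) (suc j) ds

Lρ : {n : ℕ} → ℕ → List (Fin n) → ℕ
Lρ ρ ds = collIdx [] ρ 0 ds

-- Since at most n draws are collision-free, the ρ-th collision occurs among the
-- first n + ρ draws, so L_ρ is determined by the first n + ρ draws; hence
-- E[L_ρ] = (Σ over all sequences of length n + ρ of L_ρ) / n ^ (n + ρ).
totalL : ℕ → ℕ → ℕ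
totalL n ρ = sum (map (Lρ ρ) (allSeqs n (n + ρ)))

-- Expectation E[L_ρ] for population size n (n = 0 is degenerate; set to 0).
ELρ : ℕ → ℕ → ℚ
ELρ zero    ρ = 0ℚ
ELρ (suc n) ρ = _/_ (+ totalL (suc n) ρ) (suc n ^ (suc n + ρ)) ⦃ m^n≢0 (suc n) (suc n + ρ) ⦄

-- log n, up to a constant factor (all hypotheses are invariant under this).
lg : ℕ → ℕ
lg n = ⌊log₂ n ⌋

Eventually : (ℕ → Set) → Set
Eventually P = Σ ℕ λ N → ∀ n → n ≥ N → P n

-- Expectations are handled as unnormalised sums: Σseq m f adds f over all n^m
-- draw sequences of length m, so every probabilistic statement is an inequality
-- between natural numbers.  Both bounds are drift arguments.  Peeling off the
-- first draw (it is an already seen agent for #seen s choices and a fresh one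
-- for the other #fresh s choices) turns a one-step inequality into a bound on
-- the whole sum, by induction on the number of draws left.
--
-- * Upper bound: for every b the potential j + k + (b ∸ c) + kn/b (j draws
--   made, k collisions still to find, c distinct agents seen) does not increase
--   in expectation, so E[L_ρ] ≤ ρ + b + ρn/b; choose b² ≈ ρn.
-- * Lower bound: the number X_t of collisions among the first t draws has
--   E[X_t] ≤ t²/n, and pathwise ρ·L_ρ + t·X_t ≥ ρ·t; choosing 2t² ≈ ρn gives
--   E[L_ρ] ≥ t/2.
-- Finally the growth hypotheses on q and ρ force ρ ≤ n eventually, and the two
-- bounds transfer to ℚ with constants c₁ = 1/6 and c₂ = 7.
module Submission where

open import Defs
open import Data.Nat
  using (ℕ; zero; suc; _+_; _*_; _^_; _∸_; _≤_; _≥_; _⊔_; z≤n; s≤s; NonZero; >-nonZero; _≤?_; _<?_)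
  renaming (_<_ to _<ℕ_)
open import Data.Nat.Properties
open import Data.Nat.Tactic.RingSolver using (solve-∀)
open import Data.Nat.ListAction using (sum)
open import Data.Nat.ListAction.Properties using (sum-++)
open import Data.Nat.Logarithm using (⌊log₂⌋-mono-≤)
open import Data.Fin using (Fin) renaming (_≟_ to _≟ᶠ_; zero to fzero; suc to fsuc)
open import Data.List using (List; []; _∷_; _++_; map; concatMap; length; tabulate; allFin)
import Data.List.Properties as List
open import Data.List.Membership.Propositional using (_∈_; _∉_)
open import Data.Product using (Σ; _×_; _,_)
open import Relation.Nullary using (Dec; does; yes; no; ¬_; ¬?)
open import Data.Bool using (if_then_else_)
open import Relation.Unary using (Decidable)
open import Relation.Binary.PropositionalEquality
open import Data.Empty using (⊥-elim)
open import Function using (_∘_)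

module _ {A : Set} where

  sum-map-cong : ∀ (f g : A → ℕ) xs → (∀ x → f x ≡ g x) → sum (map f xs) ≡ sum (map g xs)
  sum-map-cong f g xs f≗g = cong sum (List.map-cong f≗g xs)

  sum-map-mono : ∀ (f g : A → ℕ) xs → (∀ x → f x ≤ g x) → sum (map f xs) ≤ sum (map g xs)
  sum-map-mono f g []       f≤g = z≤n
  sum-map-mono f g (x ∷ xs) f≤g = +-mono-≤ (f≤g x) (sum-map-mono f g xs f≤g)

  sum-map-+ : ∀ (f g : A → ℕ) xs →
    sum (map (λ x → f x + g x) xs) ≡ sum (map f xs) + sum (map g xs)
  sum-map-+ f g []       = refl
  sum-map-+ f g (x ∷ xs) = begin
    (f x + g x) + sum (map (λ x → f x + g x) xs)  ≡⟨ cong (f x + g x +_) (sum-map-+ f g xs) ⟩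
    (f x + g x) + (sum (map f xs) + sum (map g xs)) ≡⟨ interchange (f x) (g x) _ _ ⟩
    (f x + sum (map f xs)) + (g x + sum (map g xs)) ∎
    where
    open ≡-Reasoning
    interchange : ∀ a b c d → (a + b) + (c + d) ≡ (a + c) + (b + d)
    interchange = solve-∀

  sum-map-* : ∀ c (f : A → ℕ) xs → sum (map (λ x → c * f x) xs) ≡ c * sum (map f xs)
  sum-map-* c f []       = sym (*-zeroʳ c)
  sum-map-* c f (x ∷ xs) =
    trans (cong (c * f x +_) (sum-map-* c f xs)) (sym (*-distribˡ-+ c (f x) _))

  sum-map-const : ∀ c (xs : List A) → sum (map (λ _ → c) xs) ≡ length xs * c
  sum-map-const c []       = refl
  sum-map-const c (x ∷ xs) = cong (c +_) (sum-map-const c xs)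

sum-map-concatMap : ∀ {A B : Set} (f : B → ℕ) (g : A → List B) xs →
  sum (map f (concatMap g xs)) ≡ sum (map (λ x → sum (map f (g x))) xs)
sum-map-concatMap f g []       = refl
sum-map-concatMap f g (x ∷ xs) = begin
  sum (map f (g x ++ concatMap g xs))          ≡⟨ cong sum (List.map-++ f (g x) _) ⟩
  sum (map f (g x) ++ map f (concatMap g xs))  ≡⟨ sum-++ (map f (g x)) _ ⟩
  sum (map f (g x)) + sum (map f (concatMap g xs))  ≡⟨ cong (sum (map f (g x)) +_) (sum-map-concatMap f g xs) ⟩
  sum (map f (g x)) + sum (map (λ x → sum (map f (g x))) xs) ∎
  where open ≡-Reasoning

𝟙 : {P : Set} → Dec P → ℕ
𝟙 d = if does d then 1 else 0

count : {A : Set} {P : A → Set} → Decidable P → List A → ℕ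
count P? xs = sum (map (𝟙 ∘ P?) xs)

module _ {A : Set} {P : A → Set} (P? : Decidable P) where

  count+count¬ : ∀ xs → count P? xs + count (¬? ∘ P?) xs ≡ length xs
  count+count¬ []       = refl
  count+count¬ (x ∷ xs) with P? x
  ... | yes _ = cong suc (count+count¬ xs)
  ... | no  _ = trans (+-suc (count P? xs) _) (cong suc (count+count¬ xs))

  count-none : ∀ xs → (∀ x → ¬ P x) → count P? xs ≡ 0
  count-none []       none = refl
  count-none (x ∷ xs) none with P? x
  ... | yes p = ⊥-elim (none x p)
  ... | no  _ = count-none xs none

  count-split : ∀ (g : A → ℕ) u v xs → (∀ x → P x → g x ≤ u) → (∀ x → ¬ P x → g x ≤ v) →
    sum (map g xs) ≤ count P? xs * u + count (¬? ∘ P?) xs * v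
  count-split g u v []       on-P off-P = z≤n
  count-split g u v (x ∷ xs) on-P off-P with P? x | count-split g u v xs on-P off-P
  ... | yes p | rest = ≤-trans (+-mono-≤ (on-P x p) rest) (≤-reflexive (sym (+-assoc u _ _)))
  ... | no ¬p | rest = ≤-trans (+-mono-≤ (off-P x ¬p) rest) (≤-reflexive (swap v (count P? xs * u) (count (¬? ∘ P?) xs * v)))
    where
    swap : ∀ a b c → a + (b + c) ≡ b + (a + c)
    swap = solve-∀

count-allFin-suc : ∀ {m} {P : Fin (suc m) → Set} (P? : Decidable P) →
  count P? (allFin (suc m)) ≡ 𝟙 (P? fzero) + count (P? ∘ fsuc) (allFin m)
count-allFin-suc {m} P? = cong (𝟙 (P? fzero) +_) (cong sum (begin
  map (𝟙 ∘ P?) (tabulate fsuc)  ≡⟨ List.map-tabulate fsuc (𝟙 ∘ P?) ⟩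
  tabulate (𝟙 ∘ P? ∘ fsuc)      ≡⟨ List.map-tabulate (λ x → x) (𝟙 ∘ P? ∘ fsuc) ⟨
  map (𝟙 ∘ P? ∘ fsuc) (allFin m)     ∎))
  where open ≡-Reasoning

count-≟ : ∀ {m} (a : Fin m) → count (_≟ᶠ a) (allFin m) ≡ 1
count-≟ {suc m} fzero    = trans (count-allFin-suc {m} (_≟ᶠ fzero))
  (cong suc (count-none (λ x → fsuc x ≟ᶠ fzero) (allFin m) (λ x ())))
count-≟ {suc m} (fsuc a) = trans (count-allFin-suc {m} (_≟ᶠ fsuc a)) (count-≟ a)

module Draws (n : ℕ) where

  open import Data.List.Membership.DecPropositional (_≟ᶠ_ {n}) using (_∈?_)

  length-allFin : length (allFin n) ≡ n
  length-allFin = List.length-tabulate {n = n} (λ a → a)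

  -- Σseq m f = n^m · E[f], the expectation being over m independent uniform draws.
  Σseq : ℕ → (List (Fin n) → ℕ) → ℕ
  Σseq m f = sum (map f (allSeqs n m))

  Σseq-first-draw : ∀ m f → Σseq (suc m) f ≡ sum (map (λ a → Σseq m (f ∘ (a ∷_))) (allFin n))
  Σseq-first-draw m f = begin
    sum (map f (concatMap (λ a → map (a ∷_) (allSeqs n m)) (allFin n)))
      ≡⟨ sum-map-concatMap f (λ a → map (a ∷_) (allSeqs n m)) (allFin n) ⟩
    sum (map (λ a → sum (map f (map (a ∷_) (allSeqs n m)))) (allFin n))
      ≡⟨ sum-map-cong _ _ (allFin n) (λ a → cong sum (List.map-∘ (allSeqs n m))) ⟨
    sum (map (λ a → Σseq m (f ∘ (a ∷_))) (allFin n)) ∎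
    where open ≡-Reasoning

  Σseq-cong : ∀ m f g → (∀ ds → f ds ≡ g ds) → Σseq m f ≡ Σseq m g
  Σseq-cong m f g = sum-map-cong f g (allSeqs n m)

  Σseq-+ : ∀ m f g → Σseq m (λ ds → f ds + g ds) ≡ Σseq m f + Σseq m g
  Σseq-+ m f g = sum-map-+ f g (allSeqs n m)

  Σseq-* : ∀ m c f → Σseq m (λ ds → c * f ds) ≡ c * Σseq m f
  Σseq-* m c f = sum-map-* c f (allSeqs n m)

  Σseq-const : ∀ m c → Σseq m (λ _ → c) ≡ n ^ m * c
  Σseq-const zero    c = refl
  Σseq-const (suc m) c = begin
    Σseq (suc m) (λ _ → c)                        ≡⟨ Σseq-first-draw m (λ _ → c) ⟩
    sum (map (λ _ → Σseq m (λ _ → c)) (allFin n)) ≡⟨ sum-map-const _ (allFin n) ⟩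
    length (allFin n) * Σseq m (λ _ → c)          ≡⟨ cong₂ _*_ length-allFin (Σseq-const m c) ⟩
    n * (n ^ m * c)                               ≡⟨ *-assoc n (n ^ m) c ⟨
    n ^ suc m * c                                 ∎
    where open ≡-Reasoning

  Σseq-mono : ∀ m f g → (∀ ds → length ds ≡ m → f ds ≤ g ds) → Σseq m f ≤ Σseq m g
  Σseq-mono zero    f g f≤g = +-monoˡ-≤ 0 (f≤g [] refl)
  Σseq-mono (suc m) f g f≤g rewrite Σseq-first-draw m f | Σseq-first-draw m g =
    sum-map-mono _ _ (allFin n) λ a →
      Σseq-mono m (f ∘ (a ∷_)) (g ∘ (a ∷_)) (λ ds len → f≤g (a ∷ ds) (cong suc len))

  #seen #fresh : List (Fin n) → ℕ
  #seen  s = count (_∈? s) (allFin n)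
  #fresh s = count (¬? ∘ (_∈? s)) (allFin n)

  #seen+#fresh : ∀ s → #seen s + #fresh s ≡ n
  #seen+#fresh s = trans (count+count¬ (_∈? s) (allFin n)) length-allFin

  #seen-[] : #seen [] ≡ 0
  #seen-[] = count-none (_∈? []) (allFin n) (λ a ())

  #seen-fresh : ∀ a s → a ∉ s → #seen (a ∷ s) ≡ suc (#seen s)
  #seen-fresh a s a∉s = begin
    count (_∈? (a ∷ s)) (allFin n)                           ≡⟨ sum-map-cong _ _ (allFin n) split-head ⟩
    sum (map (λ x → 𝟙 (x ≟ᶠ a) + 𝟙 (x ∈? s)) (allFin n))     ≡⟨ sum-map-+ _ _ (allFin n) ⟩
    count (_≟ᶠ a) (allFin n) + #seen s                       ≡⟨ cong (_+ #seen s) (count-≟ a) ⟩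
    suc (#seen s)                                            ∎
    where
    open ≡-Reasoning
    split-head : ∀ x → 𝟙 (x ∈? (a ∷ s)) ≡ 𝟙 (x ≟ᶠ a) + 𝟙 (x ∈? s)
    split-head x with x ≟ᶠ a
    ... | no _ = refl
    ... | yes refl with x ∈? s
    ...   | yes x∈s = ⊥-elim (a∉s x∈s)
    ...   | no  _   = refl

  first-draw : ∀ w m f s A B →
    (∀ a → a ∈ s → w * Σseq m (f ∘ (a ∷_)) ≤ A) →
    (∀ a → a ∉ s → w * Σseq m (f ∘ (a ∷_)) ≤ B) →
    w * Σseq (suc m) f ≤ #seen s * A + #fresh s * B
  first-draw w m f s A B seen fresh = begin
    w * Σseq (suc m) f                                        ≡⟨ cong (w *_) (Σseq-first-draw m f) ⟩
    w * sum (map (λ a → Σseq m (f ∘ (a ∷_))) (allFin n))      ≡⟨ sum-map-* w _ (allFin n) ⟨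
    sum (map (λ a → w * Σseq m (f ∘ (a ∷_))) (allFin n))      ≤⟨ count-split (_∈? s) _ A B (allFin n) seen fresh ⟩
    #seen s * A + #fresh s * B                                ∎
    where open ≤-Reasoning

  collIdx-seen : ∀ s k j a ds → a ∈ s → collIdx s (suc k) j (a ∷ ds) ≡ collIdx s k (suc j) ds
  collIdx-seen s k j a ds a∈s with a ∈? s
  ... | yes _   = refl
  ... | no  a∉s = ⊥-elim (a∉s a∈s)

  collIdx-fresh : ∀ s k j a ds → a ∉ s → collIdx s (suc k) j (a ∷ ds) ≡ collIdx (a ∷ s) (suc k) (suc j) ds
  collIdx-fresh s k j a ds a∉s with a ∈? s
  ... | yes a∈s = ⊥-elim (a∉s a∈s)
  ... | no  _   = refl

  collIdx-[] : ∀ (s : List (Fin n)) k j → collIdx s k j [] ≡ j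
  collIdx-[] s zero    j = refl
  collIdx-[] s (suc k) j = refl

  collisions : List (Fin n) → ℕ → List (Fin n) → ℕ
  collisions s zero    ds       = 0
  collisions s (suc t) []       = 0
  collisions s (suc t) (a ∷ ds) with a ∈? s
  ... | yes _ = suc (collisions s t ds)
  ... | no  _ = collisions (a ∷ s) t ds

  collisions-seen : ∀ s t a ds → a ∈ s → collisions s (suc t) (a ∷ ds) ≡ suc (collisions s t ds)
  collisions-seen s t a ds a∈s with a ∈? s
  ... | yes _   = refl
  ... | no  a∉s = ⊥-elim (a∉s a∈s)

  collisions-fresh : ∀ s t a ds → a ∉ s → collisions s (suc t) (a ∷ ds) ≡ collisions (a ∷ s) t ds
  collisions-fresh s t a ds a∉s with a ∈? s
  ... | yes a∈s = ⊥-elim (a∉s a∈s)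
  ... | no  _   = refl

-- Φ b n δ k / b = k + δ + kn/b bounds the expected number of further draws needed
-- to find k more collisions when δ = b ∸ (number of agents seen so far).
Φ : (b n δ k : ℕ) → ℕ
Φ b n δ k = b * k + b * δ + k * n

deficit-step : ∀ b c → c <ℕ b → b ∸ c ≡ suc (b ∸ suc c)
deficit-step (suc b) zero    _         = refl
deficit-step (suc b) (suc c) (s≤s c<b) = deficit-step b c c<b

-- One draw does not increase the expected potential b·j + Φ: of the n = c + r
-- agents, c are seen (a collision, using up one of the k + 1 collisions still
-- needed) and r are fresh (lowering the deficit).
potential-drift : ∀ b n c r j k → c + r ≡ n →
  c * (b * suc j + Φ b n (b ∸ c) k) + r * (b * suc j + Φ b n (b ∸ suc c) (suc k))
    ≤ n * (b * j + Φ b n (b ∸ c) (suc k))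
potential-drift b .(c + r) c r j k refl with b ≤? c
... | no b≰c rewrite deficit-step b c (≰⇒> b≰c) =
  ≤-trans (m≤m+n _ (c * (c + r))) (≤-reflexive (unsaturated b c r j k (b ∸ suc c)))
  where
  -- c < b: the deficit drops from δ + 1 to δ; the inequality has slack c·n.
  unsaturated : ∀ b c r j k δ →
    c * (b * suc j + (b * k + b * suc δ + k * (c + r)))
      + r * (b * suc j + (b * suc k + b * δ + suc k * (c + r))) + c * (c + r)
    ≡ (c + r) * (b * j + (b * suc k + b * suc δ + suc k * (c + r)))
  unsaturated = solve-∀
... | yes b≤c with m≤n⇒∃[o]m+o≡n b≤c
...   | e , refl rewrite m≤n⇒m∸n≡0 b≤c | m≤n⇒m∸n≡0 (m≤n⇒m≤1+n b≤c) =
  ≤-trans (m≤m+n _ ((b + e) * (b + e) + e * r)) (≤-reflexive (saturated b e r j k))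
  where
  -- c = b + e: both deficits are 0; the inequality has slack c² + e·r.
  saturated : ∀ b e r j k →
    (b + e) * (b * suc j + (b * k + b * 0 + k * (b + e + r)))
      + r * (b * suc j + (b * suc k + b * 0 + suc k * (b + e + r))) + ((b + e) * (b + e) + e * r)
    ≡ (b + e + r) * (b * j + (b * suc k + b * 0 + suc k * (b + e + r)))
  saturated = solve-∀

module UpperBound (n : ℕ) where
  open Draws n

  settled : ∀ b m j x → b * Σseq m (λ _ → j) ≤ n ^ m * (b * j + x)
  settled b m j x = begin
    b * Σseq m (λ _ → j)  ≡⟨ cong (b *_) (Σseq-const m j) ⟩
    b * (n ^ m * j)       ≡⟨ x*[y*z]≡y*[x*z] b (n ^ m) j ⟩
    n ^ m * (b * j)       ≤⟨ *-monoʳ-≤ (n ^ m) (m≤m+n (b * j) x) ⟩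
    n ^ m * (b * j + x)   ∎
    where
    open ≤-Reasoning
    x*[y*z]≡y*[x*z] : ∀ x y z → x * (y * z) ≡ y * (x * z)
    x*[y*z]≡y*[x*z] = solve-∀

  collIdx-upper : ∀ b m s k j → b * Σseq m (collIdx s k j) ≤ n ^ m * (b * j + Φ b n (b ∸ #seen s) k)
  collIdx-upper b zero    s k       j rewrite collIdx-[] s k j = settled b 0 j _
  collIdx-upper b (suc m) s zero    j = settled b (suc m) j _
  collIdx-upper b (suc m) s (suc k) j = begin
    b * Σseq (suc m) (collIdx s (suc k) j)
      ≤⟨ first-draw b m _ s A B on-seen on-fresh ⟩
    c * A + r * B
      ≡⟨ factor (n ^ m) c r _ _ ⟩
    n ^ m * (c * (b * suc j + Φ b n (b ∸ c) k) + r * (b * suc j + Φ b n (b ∸ suc c) (suc k)))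
      ≤⟨ *-monoʳ-≤ (n ^ m) (potential-drift b n c r j k (#seen+#fresh s)) ⟩
    n ^ m * (n * (b * j + Φ b n (b ∸ c) (suc k)))
      ≡⟨ reassociate (n ^ m) n _ ⟩
    n ^ suc m * (b * j + Φ b n (b ∸ c) (suc k)) ∎
    where
    open ≤-Reasoning
    c = #seen s
    r = #fresh s
    A = n ^ m * (b * suc j + Φ b n (b ∸ c) k)
    B = n ^ m * (b * suc j + Φ b n (b ∸ suc c) (suc k))
    on-seen : ∀ a → a ∈ s → b * Σseq m (collIdx s (suc k) j ∘ (a ∷_)) ≤ A
    on-seen a a∈s rewrite Σseq-cong m _ _ (λ ds → collIdx-seen s k j a ds a∈s) =
      collIdx-upper b m s k (suc j)
    on-fresh : ∀ a → a ∉ s → b * Σseq m (collIdx s (suc k) j ∘ (a ∷_)) ≤ B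
    on-fresh a a∉s rewrite Σseq-cong m _ _ (λ ds → collIdx-fresh s k j a ds a∉s)
                         | sym (#seen-fresh a s a∉s) =
      collIdx-upper b m (a ∷ s) (suc k) (suc j)
    factor : ∀ P c r X Y → c * (P * X) + r * (P * Y) ≡ P * (c * X + r * Y)
    factor = solve-∀
    reassociate : ∀ P n Z → P * (n * Z) ≡ n * P * Z
    reassociate = solve-∀

  Lρ-upper : ∀ ρ b → b * totalL n ρ ≤ n ^ (n + ρ) * Φ b n b ρ
  Lρ-upper ρ b with collIdx-upper b (n + ρ) [] ρ 0
  ... | bound rewrite #seen-[] | *-zeroʳ b = bound

-- One draw keeps t(c + t)/n a bound on the expected number of collisions among
-- the next t draws: of the n = c + r agents, c give a collision now and r enlarge
-- the seen set.
collision-drift : ∀ P n c r t → c + r ≡ n →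
  c * (n * (P * 1) + P * (t * (c + t))) + r * (P * (t * (suc c + t)))
    ≤ n * P * (suc t * (c + suc t))
collision-drift P .(c + r) c r t refl =
  ≤-trans (m≤m+n _ (P * (c * t + (c + r) * suc t))) (≤-reflexive (identity P c r t))
  where
  identity : ∀ P c r t →
    c * ((c + r) * (P * 1) + P * (t * (c + t))) + r * (P * (t * (suc c + t)))
      + P * (c * t + (c + r) * suc t)
    ≡ (c + r) * P * (suc t * (c + suc t))
  identity = solve-∀

module LowerBound (n : ℕ) where
  open Draws n
  open import Data.List.Membership.DecPropositional (_≟ᶠ_ {n}) using (_∈?_)

  none-expected : ∀ m {x} → n * Σseq m (λ _ → 0) ≤ x
  none-expected m =
    ≤-trans (≤-reflexive (trans (cong (n *_) (trans (Σseq-const m 0) (*-zeroʳ (n ^ m)))) (*-zeroʳ n))) z≤n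

  collisions-upper : ∀ m s t → n * Σseq m (collisions s t) ≤ n ^ m * (t * (#seen s + t))
  collisions-upper zero    s zero    = none-expected 0
  collisions-upper zero    s (suc t) = none-expected 0
  collisions-upper (suc m) s zero    = none-expected (suc m)
  collisions-upper (suc m) s (suc t) = begin
    n * Σseq (suc m) (collisions s (suc t))
      ≤⟨ first-draw n m _ s A B on-seen on-fresh ⟩
    c * A + r * B
      ≤⟨ collision-drift (n ^ m) n c r t (#seen+#fresh s) ⟩
    n ^ suc m * (suc t * (c + suc t)) ∎
    where
    open ≤-Reasoning
    c = #seen s
    r = #fresh s
    A = n * (n ^ m * 1) + n ^ m * (t * (c + t))
    B = n ^ m * (t * (suc c + t))
    on-seen : ∀ a → a ∈ s → n * Σseq m (collisions s (suc t) ∘ (a ∷_)) ≤ A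
    on-seen a a∈s = begin
      n * Σseq m (collisions s (suc t) ∘ (a ∷_))
        ≡⟨ cong (n *_) (Σseq-cong m _ _ (λ ds → collisions-seen s t a ds a∈s)) ⟩
      n * Σseq m (λ ds → 1 + collisions s t ds)
        ≡⟨ cong (n *_) (trans (Σseq-+ m _ _) (cong (_+ Σseq m (collisions s t)) (Σseq-const m 1))) ⟩
      n * (n ^ m * 1 + Σseq m (collisions s t))
        ≡⟨ *-distribˡ-+ n _ _ ⟩
      n * (n ^ m * 1) + n * Σseq m (collisions s t)
        ≤⟨ +-monoʳ-≤ (n * (n ^ m * 1)) (collisions-upper m s t) ⟩
      A ∎
    on-fresh : ∀ a → a ∉ s → n * Σseq m (collisions s (suc t) ∘ (a ∷_)) ≤ B
    on-fresh a a∉s = begin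
      n * Σseq m (collisions s (suc t) ∘ (a ∷_))
        ≡⟨ cong (n *_) (Σseq-cong m _ _ (λ ds → collisions-fresh s t a ds a∉s)) ⟩
      n * Σseq m (collisions (a ∷ s) t)
        ≤⟨ collisions-upper m (a ∷ s) t ⟩
      n ^ m * (t * (#seen (a ∷ s) + t))
        ≡⟨ cong (λ c′ → n ^ m * (t * (c′ + t))) (#seen-fresh a s a∉s) ⟩
      B ∎

  collIdx-≥ : ∀ s k j ds → j ≤ collIdx s k j ds
  collIdx-≥ s zero    j ds       = ≤-refl
  collIdx-≥ s (suc k) j []       = ≤-refl
  collIdx-≥ s (suc k) j (a ∷ ds) with a ∈? s
  ... | yes _ = ≤-trans (n≤1+n j) (collIdx-≥ s k (suc j) ds)
  ... | no  _ = ≤-trans (n≤1+n j) (collIdx-≥ (a ∷ s) (suc k) (suc j) ds)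

  collIdx-late : ∀ s k j t ds → t ≤ length ds → collisions s t ds <ℕ k → j + t ≤ collIdx s k j ds
  collIdx-late s k       j zero    ds       _         _   = ≤-trans (≤-reflexive (+-identityʳ j)) (collIdx-≥ s k j ds)
  collIdx-late s k       j (suc t) []       ()        _
  collIdx-late s zero    j (suc t) (a ∷ ds) _         ()
  collIdx-late s (suc k) j (suc t) (a ∷ ds) (s≤s t≤ℓ) few with a ∈? s
  ... | yes _ = ≤-trans (≤-reflexive (+-suc j t)) (collIdx-late s k (suc j) t ds t≤ℓ (≤-pred few))
  ... | no  _ = ≤-trans (≤-reflexive (+-suc j t)) (collIdx-late (a ∷ s) (suc k) (suc j) t ds t≤ℓ few)

  -- Pathwise trade-off: either L_ρ ≥ t, or at least ρ collisions occur among the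
  -- first t draws.
  tradeoff : ∀ ρ t ds → t ≤ length ds → ρ * t ≤ ρ * Lρ ρ ds + t * collisions [] t ds
  tradeoff ρ t ds t≤ℓ with collisions [] t ds <? ρ
  ... | yes few  = ≤-trans (*-monoʳ-≤ ρ (collIdx-late [] ρ 0 t ds t≤ℓ few)) (m≤m+n _ _)
  ... | no  many = ≤-trans (≤-reflexive (*-comm ρ t)) (≤-trans (*-monoʳ-≤ t (≮⇒≥ many)) (m≤n+m _ _))

  -- E[L_ρ] ≥ t/2 whenever 2t² ≤ ρn and t ≤ n + ρ, scaled by 2 · n^(n+ρ):
  -- averaging the trade-off gives ρt ≤ ρ·E[L_ρ] + t·E[X_t] with E[X_t] ≤ t²/n ≤ ρ/2.
  Lρ-lower : ∀ ρ t .{{_ : NonZero (n * ρ)}} → t ≤ n + ρ → 2 * (t * t) ≤ ρ * n →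
    t * n ^ (n + ρ) ≤ 2 * totalL n ρ
  Lρ-lower ρ t t≤n+ρ 2t²≤ρn = *-cancelˡ-≤ (n * ρ) (+-cancelʳ-≤ (n * ρ * (t * N)) _ _ doubled)
    where
    N = n ^ (n + ρ)
    T = totalL n ρ
    X = Σseq (n + ρ) (collisions [] t)
    averaged : N * (ρ * t) ≤ ρ * T + t * X
    averaged = begin
      N * (ρ * t)                                          ≡⟨ Σseq-const (n + ρ) (ρ * t) ⟨
      Σseq (n + ρ) (λ _ → ρ * t)                           ≤⟨ Σseq-mono (n + ρ) _ _ (λ ds len → tradeoff ρ t ds (subst (t ≤_) (sym len) t≤n+ρ)) ⟩
      Σseq (n + ρ) (λ ds → ρ * Lρ ρ ds + t * collisions [] t ds)
                                                           ≡⟨ Σseq-+ (n + ρ) _ _ ⟩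
      Σseq (n + ρ) (λ ds → ρ * Lρ ρ ds) + Σseq (n + ρ) (λ ds → t * collisions [] t ds)
                                                           ≡⟨ cong₂ _+_ (Σseq-* (n + ρ) ρ (Lρ ρ)) (Σseq-* (n + ρ) t (collisions [] t)) ⟩
      ρ * T + t * X                                        ∎
      where open ≤-Reasoning
    few-collisions : n * X ≤ N * (t * t)
    few-collisions = subst (λ c → n * X ≤ N * (t * (c + t))) #seen-[] (collisions-upper (n + ρ) [] t)
    doubled : n * ρ * (t * N) + n * ρ * (t * N) ≤ n * ρ * (2 * T) + n * ρ * (t * N)
    doubled = begin
      n * ρ * (t * N) + n * ρ * (t * N)            ≡⟨ e₁ n ρ t N ⟩
      2 * (n * (N * (ρ * t)))                      ≤⟨ *-monoʳ-≤ 2 (*-monoʳ-≤ n averaged) ⟩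
      2 * (n * (ρ * T + t * X))                    ≡⟨ e₂ n ρ T t X ⟩
      2 * (n * ρ * T) + 2 * (t * (n * X))          ≤⟨ +-monoʳ-≤ (2 * (n * ρ * T)) (*-monoʳ-≤ 2 (*-monoʳ-≤ t few-collisions)) ⟩
      2 * (n * ρ * T) + 2 * (t * (N * (t * t)))    ≡⟨ e₃ n ρ T t N ⟩
      2 * (n * ρ * T) + (t * N) * (2 * (t * t))    ≤⟨ +-monoʳ-≤ (2 * (n * ρ * T)) (*-monoʳ-≤ (t * N) 2t²≤ρn) ⟩
      2 * (n * ρ * T) + (t * N) * (ρ * n)          ≡⟨ e₄ n ρ T t N ⟩
      n * ρ * (2 * T) + n * ρ * (t * N)            ∎
      where
      open ≤-Reasoning
      e₁ : ∀ n ρ t N → n * ρ * (t * N) + n * ρ * (t * N) ≡ 2 * (n * (N * (ρ * t)))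
      e₁ = solve-∀
      e₂ : ∀ n ρ T t X → 2 * (n * (ρ * T + t * X)) ≡ 2 * (n * ρ * T) + 2 * (t * (n * X))
      e₂ = solve-∀
      e₃ : ∀ n ρ T t N → 2 * (n * ρ * T) + 2 * (t * (N * (t * t))) ≡ 2 * (n * ρ * T) + (t * N) * (2 * (t * t))
      e₃ = solve-∀
      e₄ : ∀ n ρ T t N → 2 * (n * ρ * T) + (t * N) * (ρ * n) ≡ n * ρ * (2 * T) + n * ρ * (t * N)
      e₄ = solve-∀

weighted-root : ∀ a x → Σ ℕ λ t → suc a * (t * t) ≤ x × x <ℕ suc a * (suc t * suc t)
weighted-root a zero    = 0 , ≤-reflexive (*-zeroʳ a) , s≤s z≤n
weighted-root a (suc x) with weighted-root a x
... | t , lo , hi with suc x <? suc a * (suc t * suc t)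
...   | yes below = t , m≤n⇒m≤1+n lo , below
...   | no  above = suc t , ≮⇒≥ above , ≤-<-trans hi (*-monoʳ-< (suc a) (*-mono-< (n<1+n (suc t)) (n<1+n (suc t))))

square-bracket : ∀ a x → suc a ≤ x → Σ ℕ λ t → 1 ≤ t × suc a * (t * t) ≤ x × x ≤ 4 * (suc a * (t * t))
square-bracket a x a<x with weighted-root a x
... | zero  , _  , hi = ⊥-elim (<⇒≱ (<-≤-trans hi (≤-reflexive (*-identityʳ (suc a)))) a<x)
... | suc u , lo , hi = suc u , s≤s z≤n , lo , ≤-trans (<⇒≤ hi) (begin
  suc a * ((2 + u) * (2 + u))               ≤⟨ *-monoʳ-≤ (suc a) (m≤m+n _ (3 * (u * u) + 4 * u)) ⟩
  suc a * ((2 + u) * (2 + u) + (3 * (u * u) + 4 * u)) ≡⟨ quadruple (suc a) u ⟩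
  4 * (suc a * (suc u * suc u))             ∎)
  where
  open ≤-Reasoning
  quadruple : ∀ a u → a * ((2 + u) * (2 + u) + (3 * (u * u) + 4 * u)) ≡ 4 * (a * ((1 + u) * (1 + u)))
  quadruple = solve-∀

square-cancel-≤ : ∀ a b → a * a ≤ b * b → a ≤ b
square-cancel-≤ a b a²≤b² with a ≤? b
... | yes a≤b = a≤b
... | no  a≰b = ⊥-elim (<⇒≱ (*-mono-< (≰⇒> a≰b) (≰⇒> a≰b)) a²≤b²)

-- ρn ≤ 32·E[L_ρ]², weakened to 36 = 6² and scaled by n^(2(n+ρ)): take 2t² ≈ ρn
-- in E[L_ρ] ≥ t/2.
Lρ-lower-bound : ∀ n ρ → 2 ≤ n → 1 ≤ ρ → ρ ≤ n →
  ρ * n * (n ^ (n + ρ) * n ^ (n + ρ)) ≤ 36 * (totalL n ρ * totalL n ρ)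
Lρ-lower-bound n@(suc _) ρ@(suc _) 2≤n 1≤ρ ρ≤n with square-bracket 1 (ρ * n) (*-mono-≤ 1≤ρ 2≤n)
... | t , _ , 2t²≤ρn , ρn≤8t² = begin
  ρ * n * (N * N)                ≤⟨ *-monoˡ-≤ (N * N) ρn≤8t² ⟩
  4 * (2 * (t * t)) * (N * N)    ≡⟨ e₁ t N ⟩
  8 * ((t * N) * (t * N))        ≤⟨ *-monoʳ-≤ 8 (*-mono-≤ half half) ⟩
  8 * ((2 * T) * (2 * T))        ≡⟨ e₂ T ⟩
  32 * (T * T)                   ≤⟨ *-monoˡ-≤ (T * T) (m≤m+n 32 4) ⟩
  36 * (T * T)                   ∎
  where
  open ≤-Reasoning
  N = n ^ (n + ρ)
  T = totalL n ρ
  t≤n : t ≤ n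
  t≤n = square-cancel-≤ t n (≤-trans (m≤m+n (t * t) _) (≤-trans 2t²≤ρn (*-monoˡ-≤ n ρ≤n)))
  half : t * N ≤ 2 * T
  half = LowerBound.Lρ-lower n ρ t (≤-trans t≤n (m≤m+n n ρ)) 2t²≤ρn
  e₁ : ∀ t N → 4 * (2 * (t * t)) * (N * N) ≡ 8 * ((t * N) * (t * N))
  e₁ = solve-∀
  e₂ : ∀ T → 8 * ((2 * T) * (2 * T)) ≡ 32 * (T * T)
  e₂ = solve-∀

-- E[L_ρ]² ≤ 49ρn, scaled by n^(2(n+ρ)): take b² ≈ ρn in E[L_ρ] ≤ ρ + b + ρn/b.
Lρ-upper-bound : ∀ n ρ → 1 ≤ ρ → ρ ≤ n →
  totalL n ρ * totalL n ρ ≤ 49 * (ρ * n) * (n ^ (n + ρ) * n ^ (n + ρ))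
Lρ-upper-bound n ρ 1≤ρ ρ≤n with square-bracket 0 (ρ * n) (*-mono-≤ 1≤ρ (≤-trans 1≤ρ ρ≤n))
... | b , 1≤b , b²≤ρn , ρn≤4b² = begin
  T * T                      ≤⟨ *-mono-≤ T≤7bN T≤7bN ⟩
  (7 * b * N) * (7 * b * N)  ≡⟨ e₁ b N ⟩
  49 * (1 * (b * b)) * (N * N) ≤⟨ *-monoˡ-≤ (N * N) (*-monoʳ-≤ 49 b²≤ρn) ⟩
  49 * (ρ * n) * (N * N)     ∎
  where
  open ≤-Reasoning
  N = n ^ (n + ρ)
  T = totalL n ρ
  e₁ : ∀ b N → (7 * b * N) * (7 * b * N) ≡ 49 * (1 * (b * b)) * (N * N)
  e₁ = solve-∀
  e₂ : ∀ b → 4 * (1 * (b * b)) ≡ 2 * b * (2 * b)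
  e₂ = solve-∀
  e₃ : ∀ b → b * (2 * b) + b * b + 4 * (1 * (b * b)) ≡ b * (7 * b)
  e₃ = solve-∀
  e₄ : ∀ N b → N * (b * (7 * b)) ≡ b * (7 * b * N)
  e₄ = solve-∀
  ρ≤2b : ρ ≤ 2 * b
  ρ≤2b = square-cancel-≤ ρ (2 * b) (begin
    ρ * ρ                ≤⟨ *-monoʳ-≤ ρ ρ≤n ⟩
    ρ * n                ≤⟨ ρn≤4b² ⟩
    4 * (1 * (b * b))    ≡⟨ e₂ b ⟩
    2 * b * (2 * b)      ∎)
  potential-small : Φ b n b ρ ≤ b * (7 * b)
  potential-small = begin
    b * ρ + b * b + ρ * n                   ≤⟨ +-mono-≤ (+-monoˡ-≤ (b * b) (*-monoʳ-≤ b ρ≤2b)) ρn≤4b² ⟩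
    b * (2 * b) + b * b + 4 * (1 * (b * b)) ≡⟨ e₃ b ⟩
    b * (7 * b)                             ∎
  T≤7bN : T ≤ 7 * b * N
  T≤7bN = *-cancelˡ-≤ b {{>-nonZero 1≤b}} (begin
    b * T                ≤⟨ UpperBound.Lρ-upper n ρ b ⟩
    N * Φ b n b ρ        ≤⟨ *-monoʳ-≤ N potential-small ⟩
    N * (b * (7 * b))    ≡⟨ e₄ N b ⟩
    b * (7 * b * N)      ∎)

open import Data.Integer using (+_)
import Data.Integer as ℤ
import Data.Integer.Properties as ℤ
open import Data.Rational using (ℚ; 0ℚ; _<_; _/_; toℚᵘ) renaming (_≤_ to _≤ℚ_; _*_ to _*ℚ_)
import Data.Rational.Properties as ℚ
open import Data.Rational.Unnormalised using (*≤*) renaming (_≃_ to _≃ᵘ_; _*_ to _*ᵘ_; _/_ to _/ᵘ_)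
import Data.Rational.Unnormalised.Properties as ℚᵘ

toℚᵘ-fraction-product : ∀ a b c d .{{_ : NonZero b}} .{{_ : NonZero d}} →
  toℚᵘ ((+ a / b) *ℚ (+ c / d)) ≃ᵘ ((+ a /ᵘ b) *ᵘ (+ c /ᵘ d))
toℚᵘ-fraction-product a b c d = ℚᵘ.≃-trans (ℚ.toℚᵘ-homo-* (+ a / b) (+ c / d))
  (ℚᵘ.*-cong (fraction a b) (fraction c d))
  where
  fraction : ∀ a b .{{_ : NonZero b}} → toℚᵘ (+ a / b) ≃ᵘ (+ a /ᵘ b)
  fraction a (suc b) = ℚ.toℚᵘ-fromℚᵘ (+ a /ᵘ suc b)

fraction-product-≤ : ∀ a b c d e f g h .{{_ : NonZero b}} .{{_ : NonZero d}} .{{_ : NonZero f}} .{{_ : NonZero h}} →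
  a * c * (f * h) ≤ e * g * (b * d) → (+ a / b) *ℚ (+ c / d) ≤ℚ (+ e / f) *ℚ (+ g / h)
fraction-product-≤ a b@(suc _) c d@(suc _) e f@(suc _) g h@(suc _) ac·fh≤eg·bd = ℚ.toℚᵘ-cancel-≤
  (ℚᵘ.≤-respˡ-≃ (ℚᵘ.≃-sym (toℚᵘ-fraction-product a b c d))
  (ℚᵘ.≤-respʳ-≃ (ℚᵘ.≃-sym (toℚᵘ-fraction-product e f g h))
  (*≤* (subst₂ ℤ._≤_ (as-ℤ a c f h) (as-ℤ e g b d) (ℤ.+≤+ ac·fh≤eg·bd)))))
  where
  as-ℤ : ∀ w x y z → + (w * x * (y * z)) ≡ (+ w ℤ.* + x) ℤ.* (+ y ℤ.* + z)
  as-ℤ w x y z = trans (ℤ.pos-* (w * x) (y * z)) (cong₂ ℤ._*_ (ℤ.pos-* w x) (ℤ.pos-* y z))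

ELρ-bounds : ∀ n ρ → 2 ≤ n → 1 ≤ ρ → ρ ≤ n →
    ((+ 1 / 6) *ℚ (+ 1 / 6)) *ℚ ((+ (ρ * n)) / 1) ≤ℚ ELρ n ρ *ℚ ELρ n ρ
  × ELρ n ρ *ℚ ELρ n ρ ≤ℚ ((+ 7 / 1) *ℚ (+ 7 / 1)) *ℚ ((+ (ρ * n)) / 1)
ELρ-bounds n@(suc _) ρ 2≤n 1≤ρ ρ≤n =
    fraction-product-≤ 1 36 (ρ * n) 1 T N T N lower
  , fraction-product-≤ T N T N 49 1 (ρ * n) 1 upper
  where
  N = n ^ (n + ρ)
  T = totalL n ρ
  instance
    N≢0 : NonZero N
    N≢0 = m^n≢0 n (n + ρ)
  lower : 1 * (ρ * n) * (N * N) ≤ T * T * 36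
  lower = ≤-trans (≤-reflexive (cong (_* (N * N)) (*-identityˡ (ρ * n))))
    (≤-trans (Lρ-lower-bound n ρ 2≤n 1≤ρ ρ≤n) (≤-reflexive (*-comm 36 (T * T))))
  upper : T * T * 1 ≤ 49 * (ρ * n) * (N * N)
  upper = ≤-trans (≤-reflexive (*-identityʳ (T * T))) (Lρ-upper-bound n ρ 1≤ρ ρ≤n)

eventually-mono : {P Q : ℕ → Set} → (∀ n → P n → Q n) → Eventually P → Eventually Q
eventually-mono P⇒Q (N , P-from-N) = N , λ n n≥N → P⇒Q n (P-from-N n n≥N)

eventually-× : {P Q : ℕ → Set} → Eventually P → Eventually Q → Eventually (λ n → P n × Q n)
eventually-× (N , P-from-N) (M , Q-from-M) = N ⊔ M , λ n n≥N⊔M →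
  P-from-N n (≤-trans (m≤m⊔n N M) n≥N⊔M) , Q-from-M n (≤-trans (m≤n⊔m N M) n≥N⊔M)

eventually-≥ : ∀ N → Eventually (N ≤_)
eventually-≥ N = N , λ n n≥N → n≥N

-- ρ·lg n ≤ C·Q < (C+1)·Q ≤ n·lg n forces ρ ≤ n as soon as lg n ≥ 1.
ρ≤n-from-logs : ∀ n ρ Q C → 2 ≤ n → ρ * lg n ≤ C * Q → suc C * Q ≤ n * lg n → ρ ≤ n
ρ≤n-from-logs n ρ Q C 2≤n ρ-small Q-small =
  *-cancelʳ-≤ ρ n (lg n) {{>-nonZero (⌊log₂⌋-mono-≤ 2≤n)}}
    (≤-trans ρ-small (≤-trans (m≤n+m (C * Q) Q) Q-small))

-- The upper growth bound on q together with the bound on ρ gives ρ ≤ n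
-- eventually, and from then on c₁ = 1/6 and c₂ = 7 work.
lemma8 : (q ρ : ℕ → ℕ) → (∀ n → q n ≥ 1) → (∀ n → ρ n ≥ 1)
    → (∀ C → Eventually (λ n → C * lg n ≤ q n * q n))
    → (∀ C → C ≥ 1 → Eventually (λ n → C * (q n * q n) ≤ n * lg n))
    → Σ ℕ (λ C → Eventually (λ n → ρ n * lg n ≤ C * (q n * q n)))
    → Σ ℚ (λ c₁ → Σ ℚ (λ c₂ → (0ℚ < c₁) × (0ℚ < c₂) × Eventually (λ n →
         ((c₁ *ℚ c₁) *ℚ ((+ (ρ n * n)) / 1) ≤ℚ ELρ n (ρ n) *ℚ ELρ n (ρ n))
         × (ELρ n (ρ n) *ℚ ELρ n (ρ n) ≤ℚ (c₂ *ℚ c₂) *ℚ ((+ (ρ n * n)) / 1)))))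
lemma8 q ρ _ ρ≥1 _ q²-small (C , ρ-small) =
  + 1 / 6 , + 7 / 1 , ℚ.positive⁻¹ (+ 1 / 6) , ℚ.positive⁻¹ (+ 7 / 1) ,
  eventually-mono bounds
    (eventually-× (eventually-≥ 2) (eventually-× ρ-small (q²-small (suc C) (s≤s z≤n))))
  where
  bounds : ∀ n → 2 ≤ n × ρ n * lg n ≤ C * (q n * q n) × suc C * (q n * q n) ≤ n * lg n →
      ((+ 1 / 6) *ℚ (+ 1 / 6)) *ℚ ((+ (ρ n * n)) / 1) ≤ℚ ELρ n (ρ n) *ℚ ELρ n (ρ n)
    × ELρ n (ρ n) *ℚ ELρ n (ρ n) ≤ℚ ((+ 7 / 1) *ℚ (+ 7 / 1)) *ℚ ((+ (ρ n * n)) / 1)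
  bounds n (2≤n , ρ-lg , q-lg) =
    ELρ-bounds n (ρ n) 2≤n (ρ≥1 n) (ρ≤n-from-logs n (ρ n) (q n * q n) C 2≤n ρ-lg q-lg)
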